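{- Let $q\neq 1$ be real and define polynomials $F_n(x,s,q)$ in $x,s$ by $F_0(x,s,q)=0$, $F_1(x,s,q)=1$ and $F_n(x,s,q)=xF_{n-1}(x,s,q)+q^{n-2}sF_{n-2}(x,s,q)$ for $n\ge 2$. Then for all $n\ge1$, $$F_n(x,s,q)F_n(x,qs,q)-F_{n-1}(x,qs,q)F_{n+1}(x,s,q)=q^{\binom n2}(-s)^{n-1}.$$
   Context: $F_n(x,s,q)$ is Carlitz's (arithmetical) $q$-Fibonacci polynomial; $F_n(x,qs,q)$ denotes the substitution $s\mapsto qs$. -}

module Defs where

open import Level using (Level)
open import Data.Nat using (ℕ; zero; suc)
open import Algebra.Bundles using (CommutativeRing)

module CarlitzFib {c ℓ : Level} (R : CommutativeRing c ℓ) where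
  open CommutativeRing R

  pow : Carrier → ℕ → Carrier
  pow a zero    = 1#
  pow a (suc n) = a * pow a n

  F : ℕ → Carrier → Carrier → Carrier → Carrier
  F zero          x s q = 0#
  F (suc zero)    x s q = 1#
  F (suc (suc n)) x s q = x * F (suc n) x s q + pow q n * s * F n x s q

{-# OPTIONS --safe #-}
-- Write Dₙ for the left-hand side. Unfolding the recurrence once in both
-- F (n + 2) x s q and F (n + 2) x (q s) q, the terms quadratic in x cancel and
-- what remains is D (n + 1) = - q ^ (n + 1) s · Dₙ. Since D₀ = 1 and
-- (n + 2 choose 2) = (n + 1) + (n + 1 choose 2), the closed form follows by induction.
module Submission where

open import Defs
open import Level using (Level)
open import Data.Nat using (ℕ; suc; zero)
import Data.Nat as ℕ
open import Data.Nat.Combinatorics using (_C_; nC1≡n; nCk+nC[k+1]≡[n+1]C[k+1])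
open import Algebra.Bundles using (CommutativeRing)
open import Relation.Nullary using (¬_)
import Relation.Binary.PropositionalEquality as ≡
import Relation.Binary.Reasoning.Setoid as SetoidReasoning
import Algebra.Solver.Ring.NaturalCoefficients.Default as NaturalSolver
import Algebra.Properties.Ring as RingProperties
import Algebra.Properties.AbelianGroup as AbelianGroupProperties

[m+1]C2≡m+mC2 : ∀ m → suc m C 2 ≡.≡ m ℕ.+ m C 2
[m+1]C2≡m+mC2 m = ≡.trans (≡.sym (nCk+nC[k+1]≡[n+1]C[k+1] m 1))
                          (≡.cong (ℕ._+ m C 2) (nC1≡n m))

module CarlitzDeterminant {c ℓ : Level} (R : CommutativeRing c ℓ) where
  open CommutativeRing R hiding (zero)
  open CarlitzFib R
  open NaturalSolver commutativeSemiring using (solve; _:=_; _:+_; _:*_)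
  open RingProperties ring using (-0#≈0#; x[y-z]≈xy-xz; -‿distribˡ-*; -‿distribʳ-*)
  open AbelianGroupProperties +-abelianGroup using (⁻¹-anti-homo‿-)
  open SetoidReasoning setoid

  pow-+ : ∀ a m n → pow a (m ℕ.+ n) ≈ pow a m * pow a n
  pow-+ a zero    n = sym (*-identityˡ _)
  pow-+ a (suc m) n = trans (*-cong refl (pow-+ a m n)) (sym (*-assoc _ _ _))

  x+w≈z+y⇒x-y≈z-w : ∀ x y z w → x + w ≈ z + y → x - y ≈ z - w
  x+w≈z+y⇒x-y≈z-w x y z w x+w≈z+y = begin
    x - y                     ≈⟨ sym (+-identityʳ _) ⟩
    (x - y) + 0#              ≈⟨ +-cong refl (sym (-‿inverseʳ w)) ⟩
    (x - y) + (w - w)         ≈⟨ solve 4 (λ a b c d → (a :+ b) :+ (c :+ d) := (a :+ c) :+ (b :+ d)) refl x (- y) w (- w) ⟩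
    (x + w) + (- y - w)       ≈⟨ +-cong x+w≈z+y refl ⟩
    (z + y) + (- y - w)       ≈⟨ solve 4 (λ a b c d → (a :+ b) :+ (c :+ d) := (a :+ d) :+ (b :+ c)) refl z y (- y) (- w) ⟩
    (z - w) + (y - y)         ≈⟨ +-cong refl (-‿inverseʳ y) ⟩
    (z - w) + 0#              ≈⟨ +-identityʳ _ ⟩
    z - w                     ∎

  -x*[y-z]≈x*z-x*y : ∀ x y z → - x * (y - z) ≈ x * z - x * y
  -x*[y-z]≈x*z-x*y x y z = begin
    - x * (y - z)             ≈⟨ sym (-‿distribˡ-* x _) ⟩
    - (x * (y - z))           ≈⟨ -‿cong (x[y-z]≈xy-xz x y z) ⟩
    - (x * y - x * z)         ≈⟨ ⁻¹-anti-homo‿- _ _ ⟩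
    x * z - x * y             ∎

  module _ (x s q : Carrier) where

    det : ℕ → Carrier
    det n = F (suc n) x s q * F (suc n) x (q * s) q - F n x (q * s) q * F (suc (suc n)) x s q

    det-zero : det zero ≈ 1# * 1#
    det-zero = trans (+-cong refl (trans (-‿cong (zeroˡ _)) -0#≈0#)) (+-identityʳ _)

    det-suc : ∀ n → det (suc n) ≈ (pow q (suc n) * - s) * det n
    det-suc n = begin
      det (suc n)                   ≈⟨ x+w≈z+y⇒x-y≈z-w _ _ _ _ (semiring-form a b c′ d (pow q n)) ⟩
      k * s * (d * F₂) - k * s * (a * c′)
                                    ≈⟨ sym (-x*[y-z]≈x*z-x*y (k * s) _ _) ⟩
      - (k * s) * det n             ≈⟨ *-cong (-‿distribʳ-* k s) refl ⟩
      (k * - s) * det n             ∎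
      where
      a b c′ d k F₂ : Carrier
      a = F (suc n) x s q
      b = F n x s q
      c′ = F (suc n) x (q * s) q
      d = F n x (q * s) q
      k = pow q (suc n)
      F₂ = F (suc (suc n)) x s q
      -- The identity D (n + 1) ≈ - q ^ (n + 1) s · Dₙ with both subtracted terms moved
      -- across, so that it becomes a commutative-semiring identity.
      semiring-form : ∀ a b c′ d p →
        (x * a + p * s * b) * (x * c′ + p * (q * s) * d) + (q * p) * s * (a * c′)
          ≈ (q * p) * s * (d * (x * a + p * s * b)) + c′ * (x * (x * a + p * s * b) + (q * p) * s * a)
      semiring-form = solve 8 (λ x s q a b c′ d p →
        (x :* a :+ p :* s :* b) :* (x :* c′ :+ p :* (q :* s) :* d) :+ (q :* p) :* s :* (a :* c′)
          := (q :* p) :* s :* (d :* (x :* a :+ p :* s :* b))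
             :+ c′ :* (x :* (x :* a :+ p :* s :* b) :+ (q :* p) :* s :* a)) refl x s q

    det-closed : ∀ n → det n ≈ pow q (suc n C 2) * pow (- s) n
    det-closed zero    = det-zero
    det-closed (suc n) = begin
      det (suc n)                                               ≈⟨ det-suc n ⟩
      (pow q (suc n) * - s) * det n                             ≈⟨ *-cong refl (det-closed n) ⟩
      (pow q (suc n) * - s) * (pow q (suc n C 2) * pow (- s) n) ≈⟨ interchange _ _ _ _ ⟩
      (pow q (suc n) * pow q (suc n C 2)) * pow (- s) (suc n)   ≈⟨ *-cong (sym (pow-+ q (suc n) _)) refl ⟩
      pow q (suc n ℕ.+ suc n C 2) * pow (- s) (suc n)           ≡⟨ ≡.cong (λ e → pow q e * pow (- s) (suc n)) (≡.sym ([m+1]C2≡m+mC2 (suc n))) ⟩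
      pow q (suc (suc n) C 2) * pow (- s) (suc n)               ∎
      where
      interchange : ∀ a b c d → (a * b) * (c * d) ≈ (a * c) * (b * d)
      interchange = solve 4 (λ a b c d → (a :* b) :* (c :* d) := (a :* c) :* (b :* d)) refl

mainTheorem3 : {c ℓ : Level} (R : CommutativeRing c ℓ) →
    let open CommutativeRing R
        open CarlitzFib R
    in
    (q x s : Carrier) → ¬ (q ≈ 1#) → (n : ℕ) →
    F (suc n) x s q * F (suc n) x (q * s) q - F n x (q * s) q * F (suc (suc n)) x s q
      ≈ pow q (suc n C 2) * pow (- s) n
mainTheorem3 R q x s _ n = CarlitzDeterminant.det-closed R x s q n
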